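{- For positive integers $m,n$, $r_<(K_m^1,K_n^1)=R(m,n)+m+n-1$. In particular, for the complete with 1-pendant graph $K_n^1$ on $n+1$ vertices, $r_<(K_n^1)=R(n,n)+2n-1$.
   Context: An ordered graph on $k$ vertices is a graph with vertex set $[k]=\{1,\dots,k\}$ with the natural order. For an integer $k\ge1$, $K_k^1$ denotes the ordered graph on vertex set $\{1,\dots,k+1\}$ whose edges are all pairs $\{i,j\}$ with $2\le i<j\le k+1$ together with the edge $\{1,2\}$. Given a red/blue coloring of the edges of the complete graph on $[N]$, a red (resp. blue) ordered copy of an ordered graph $H$ on $[k]$ is a strictly increasing map $\phi:[k]\to[N]$ such that every edge $\{\phi(i),\phi(j)\}$ with $\{i,j\}\in E(H)$ is red (resp. blue). The ordered Ramsey number $r_<(H_1,H_2)$ is the least $N$ such that every red/blue coloring of the edges of the complete graph on $[N]$ contains a red ordered copy of $H_1$ or a blue ordered copy of $H_2$; $r_<(H)=r_<(H,H)$. $R(m,n)$ is the least $N$ such that every red/blue coloring of the edges of $K_N$ contains a red $K_m$ or a blue $K_n$. -}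

module Defs where

open import Data.Nat using (ℕ; zero; suc; _+_; _∸_; _<_; _≤_)
open import Data.Fin using (Fin; toℕ)
open import Data.Bool using (Bool; true; false)
open import Data.Product using (Σ; _×_; _,_)
open import Data.Sum using (_⊎_)
open import Function.Definitions using (Injective)
open import Relation.Binary.PropositionalEquality using (_≡_; _≢_)
open import Relation.Nullary using (¬_)

-- The colour of the edge
-- {u,v} with toℕ u < toℕ v is  c u v ; values of c for u ≥ v are ignored.
-- true = red, false = blue.
Colouring : ℕ → Set
Colouring N = Fin N → Fin N → Bool

red blue : Bool
red = true
blue = false

edgeColour : ∀ {N} → Colouring N → Fin N → Fin N → Bool
edgeColour c u v with Data.Nat._<?_ (toℕ u) (toℕ v)
  where open import Data.Nat
... | Relation.Nullary.yes _ = c u v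
... | Relation.Nullary.no _ = c v u

-- An ordered graph on k vertices: vertex set Fin k with its natural order
-- and an edge relation; Edge i j is consulted only for toℕ i < toℕ j.
record OrdGraph : Set₁ where
  field
    size : ℕ
    Edge : Fin size → Fin size → Set
open OrdGraph public

StrictlyIncreasing : ∀ {k N} → (Fin k → Fin N) → Set
StrictlyIncreasing {k} φ = ∀ (i j : Fin k) → toℕ i < toℕ j → toℕ (φ i) < toℕ (φ j)

MonoCopy : ∀ {N} → Colouring N → Bool → OrdGraph → Set
MonoCopy {N} c col H =
  Σ (Fin (size H) → Fin N) λ φ →
    StrictlyIncreasing φ ×
    (∀ (i j : Fin (size H)) → toℕ i < toℕ j → Edge H i j → c (φ i) (φ j) ≡ col)

OrdArrows : ℕ → OrdGraph → OrdGraph → Set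
OrdArrows N H₁ H₂ = ∀ (c : Colouring N) → MonoCopy c red H₁ ⊎ MonoCopy c blue H₂

IsOrdRamsey : OrdGraph → OrdGraph → ℕ → Set
IsOrdRamsey H₁ H₂ N = OrdArrows N H₁ H₂ × (∀ M → M < N → ¬ OrdArrows M H₁ H₂)

-- K_k^1 : vertices 1..k+1 (here Fin (suc k) = 0..k); edges all pairs among
-- 2..k+1 (here 1..k) plus the edge {1,2} (here {0,1}).
Kpend : ℕ → OrdGraph
Kpend k = record
  { size = suc k
  ; Edge = λ i j → (1 ≤ toℕ i) ⊎ (toℕ i ≡ 0 × toℕ j ≡ 1)
  }

MonoClique : ∀ {N} → Colouring N → Bool → ℕ → Set
MonoClique {N} c col m =
  Σ (Fin m → Fin N) λ φ → Injective _≡_ _≡_ φ ×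
    (∀ (i j : Fin m) → i ≢ j → edgeColour c (φ i) (φ j) ≡ col)

Arrows : ℕ → ℕ → ℕ → Set
Arrows N m n = ∀ (c : Colouring N) → MonoClique c red m ⊎ MonoClique c blue n

IsRamsey : ℕ → ℕ → ℕ → Set
IsRamsey m n N = Arrows N m n × (∀ M → M < N → ¬ Arrows M m n)

-- Upper bound: on R + m + n - 1 vertices, sort every vertex v > 0 by the colours
-- of the edges from earlier vertices into v.  Either n vertices receive only blue
-- edges (with vertex 0 as pendant they span a blue K_n^1), or m receive only red,
-- or R receive both colours; then a monochromatic K_m or K_n of the colouring
-- restricted to these R vertices takes its pendant from the back edges of its
-- first vertex.
-- Lower bound: put a low block of n vertices and a middle block of m - 1 vertices
-- in front of a colouring of K_{R-1} with no red K_m and no blue K_n (the high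
-- block).  Edges into the low block are blue, edges into the middle block red,
-- low–high edges red and middle–high edges blue.  A red K_m^1 cannot start in the
-- low block (its pendant edge is blue) nor in the middle block (which is too
-- small, and leaving it costs a blue edge); a blue K_n^1 cannot start in the
-- middle block (pendant edge red) nor in the low block (its first vertex is not
-- vertex 0, so its n clique vertices do not fit there and one edge leaves the low
-- block, in red).  So a copy starts in the high block, where its clique is a
-- clique of the original colouring.
module Submission where

open import Defs
open import Data.Nat using (ℕ; zero; suc; _+_; _∸_; _≤_; _<_; z≤n; s≤s; s≤s⁻¹; _<?_)
open import Data.Nat.Properties
open import Data.Nat.Tactic.RingSolver using (solve-∀)
open import Data.Fin using (Fin; zero; suc; toℕ; fromℕ; inject₁; inject≤; reduce≥; punchIn; punchOut)
open import Data.Fin.Properties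
  using (¬Fin0; toℕ-injective; toℕ-inject₁; toℕ-inject≤; any?;
         punchInᵢ≢i; punchIn-injective; punchOut-injective; punchIn-punchOut)
  renaming (_≟_ to _≟ᶠ_)
open import Data.Vec.Functional using (_∷_)
open import Data.Bool using (Bool)
open import Data.Bool.Properties using (¬-not) renaming (_≟_ to _≟ᵇ_)
open import Data.Product using (Σ; ∃; _×_; _,_; proj₁; proj₂)
open import Data.Sum using (_⊎_; inj₁; inj₂; map)
open import Data.Empty using (⊥-elim)
open import Function using (_∘_)
open import Function.Definitions using (Injective)
open import Relation.Binary.PropositionalEquality
  using (_≡_; _≢_; refl; sym; trans; cong; subst; subst₂)
open import Relation.Binary.Definitions using (tri<; tri≈; tri>)
open import Relation.Nullary using (¬_; Dec; yes; no)
open import Relation.Nullary.Decidable using (_×-dec_)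

red≢blue : red ≢ blue
red≢blue ()

module _ {k N} {φ : Fin k → Fin N} (φ↑ : StrictlyIncreasing φ) where

  increasing⇒monotone : ∀ i j → toℕ i ≤ toℕ j → toℕ (φ i) ≤ toℕ (φ j)
  increasing⇒monotone i j i≤j with m≤n⇒m<n∨m≡n i≤j
  ... | inj₁ i<j = <⇒≤ (φ↑ i j i<j)
  ... | inj₂ i≡j = ≤-reflexive (cong (toℕ ∘ φ) (toℕ-injective i≡j))

  increasing-reflects-< : ∀ i j → toℕ (φ i) < toℕ (φ j) → toℕ i < toℕ j
  increasing-reflects-< i j φi<φj =
    ≰⇒> (λ j≤i → <⇒≱ φi<φj (increasing⇒monotone j i j≤i))

  increasing⇒injective : Injective _≡_ _≡_ φ
  increasing⇒injective {i} {j} φi≡φj with <-cmp (toℕ i) (toℕ j)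
  ... | tri< i<j _ _ = ⊥-elim (<⇒≢ (φ↑ i j i<j) (cong toℕ φi≡φj))
  ... | tri≈ _ i≡j _ = toℕ-injective i≡j
  ... | tri> _ _ j<i = ⊥-elim (<⇒≢ (φ↑ j i j<i) (cong toℕ (sym φi≡φj)))

increasing-spread : ∀ {k N} {φ : Fin (suc k) → Fin N} → StrictlyIncreasing φ →
                    toℕ (φ zero) + k ≤ toℕ (φ (fromℕ k))
increasing-spread {zero} {φ = φ} _ = ≤-reflexive (+-identityʳ (toℕ (φ zero)))
increasing-spread {suc k} {φ = φ} φ↑ = begin
  toℕ (φ zero) + suc k                 ≡⟨ +-suc (toℕ (φ zero)) k ⟩
  suc (toℕ (φ zero) + k)               ≤⟨ s≤s (increasing-spread φ∘inject₁↑) ⟩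
  suc (toℕ (φ (inject₁ (fromℕ k))))    ≤⟨ φ↑ (inject₁ (fromℕ k)) (fromℕ (suc k)) last-< ⟩
  toℕ (φ (fromℕ (suc k)))              ∎
  where
  open ≤-Reasoning
  φ∘inject₁↑ : StrictlyIncreasing (φ ∘ inject₁)
  φ∘inject₁↑ i j = φ↑ (inject₁ i) (inject₁ j) ∘ subst₂ _<_ (sym (toℕ-inject₁ i)) (sym (toℕ-inject₁ j))
  last-< : toℕ (inject₁ (fromℕ k)) < toℕ (fromℕ (suc k))
  last-< = s≤s (≤-reflexive (toℕ-inject₁ (fromℕ k)))

∘-increasing : ∀ {k M N} {ψ : Fin M → Fin N} {φ : Fin k → Fin M} →
               StrictlyIncreasing ψ → StrictlyIncreasing φ → StrictlyIncreasing (ψ ∘ φ)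
∘-increasing ψ↑ φ↑ i j i<j = ψ↑ _ _ (φ↑ i j i<j)

suc-increasing : ∀ {N} → StrictlyIncreasing {N} suc
suc-increasing _ _ = s≤s

∷-increasing : ∀ {k N} {x : Fin N} {φ : Fin k → Fin N} →
               (∀ i → toℕ x < toℕ (φ i)) → StrictlyIncreasing φ → StrictlyIncreasing (x ∷ φ)
∷-increasing x<φ φ↑ zero    (suc j) _         = x<φ j
∷-increasing x<φ φ↑ (suc i) (suc j) (s≤s i<j) = φ↑ i j i<j

record IncreasingIn {N} (P : Fin N → Set) (k : ℕ) : Set where
  constructor enumeration
  field
    point      : Fin k → Fin N
    increasing : StrictlyIncreasing point
    point∈P    : ∀ i → P (point i)

module _ {N} {P : Fin N → Set} where

  [_]ᴵ : ∀ {x} → P x → IncreasingIn P 1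
  [_]ᴵ {x} px = enumeration (λ _ → x) (λ { zero zero () }) (λ _ → px)

  composeᴵ : ∀ {M k} {φ : Fin M → Fin N} → StrictlyIncreasing φ →
             IncreasingIn (P ∘ φ) k → IncreasingIn P k
  composeᴵ φ↑ (enumeration ψ ψ↑ pψ) = enumeration _ (∘-increasing φ↑ ψ↑) pψ

  mapᴵ : ∀ {Q : Fin N → Set} {k} → (∀ {v} → Q v → P v) → IncreasingIn Q k → IncreasingIn P k
  mapᴵ Q⇒P (enumeration φ φ↑ qφ) = enumeration φ φ↑ (Q⇒P ∘ qφ)

infixr 5 _∷ᴵ_
_∷ᴵ_ : ∀ {N} {P : Fin (suc N) → Set} {k} → P zero → IncreasingIn (P ∘ suc) k → IncreasingIn P (suc k)
p₀ ∷ᴵ enumeration φ φ↑ pφ =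
  enumeration (zero ∷ (suc ∘ φ)) (∷-increasing (λ _ → s≤s z≤n) (∘-increasing suc-increasing φ↑))
              λ { zero → p₀ ; (suc i) → pφ i }

Image : ∀ {m N} → (Fin m → Fin N) → Fin N → Set
Image f v = ∃ λ i → f i ≡ v

mutual
  increasing-image : ∀ {m N} (f : Fin m → Fin N) → Injective _≡_ _≡_ f → IncreasingIn (Image f) m
  increasing-image {zero}          f _     = enumeration (λ ()) (λ ()) (λ ())
  increasing-image {suc m} {zero}  f _     = ⊥-elim (¬Fin0 (f zero))
  increasing-image {suc m} {suc N} f f-inj with any? (λ i → f i ≟ᶠ zero)
  ... | yes (j , fj≡0) =
    (j , fj≡0) ∷ᴵ mapᴵ (λ (i , e) → punchIn j i , e)
                       (increasing-image-avoiding0 (f ∘ punchIn j) 0∉f′ f′-inj)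
    where
    0∉f′ : ∀ i → zero ≢ f (punchIn j i)
    0∉f′ i 0≡f′i = punchInᵢ≢i j i (f-inj (trans (sym 0≡f′i) (sym fj≡0)))
    f′-inj : Injective _≡_ _≡_ (f ∘ punchIn j)
    f′-inj = punchIn-injective j _ _ ∘ f-inj
  ... | no 0∉f =
    composeᴵ suc-increasing (increasing-image-avoiding0 f (λ i 0≡fi → 0∉f (i , sym 0≡fi)) f-inj)

  increasing-image-avoiding0 : ∀ {m N} (f : Fin m → Fin (suc N)) → (0∉f : ∀ i → zero ≢ f i) →
    Injective _≡_ _≡_ f → IncreasingIn (Image f ∘ suc) m
  increasing-image-avoiding0 f 0∉f f-inj =
    mapᴵ (λ (i , e) → i , trans (sym (punchIn-punchOut (0∉f i))) (cong suc e))
         (increasing-image (λ i → punchOut (0∉f i)) (f-inj ∘ punchOut-injective (0∉f _) (0∉f _)))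

pigeonhole₂ : ∀ {N} {A B : Fin N → Set} → (∀ v → A v ⊎ B v) → ∀ a b → suc (a + b) ≤ N →
              IncreasingIn A (suc a) ⊎ IncreasingIn B (suc b)
pigeonhole₂ {zero} _ _ _ ()
pigeonhole₂ {suc N} A∪B a b a+b<N with A∪B zero
pigeonhole₂ {suc N} A∪B zero    b _                 | inj₁ A₀ = inj₁ [ A₀ ]ᴵ
pigeonhole₂ {suc N} A∪B (suc a) b (s≤s a+b<N)       | inj₁ A₀ =
  map (A₀ ∷ᴵ_) (composeᴵ suc-increasing) (pigeonhole₂ (A∪B ∘ suc) a b a+b<N)
pigeonhole₂ {suc N} A∪B a zero    _                 | inj₂ B₀ = inj₂ [ B₀ ]ᴵ
pigeonhole₂ {suc N} A∪B a (suc b) (s≤s a+1+b<N)     | inj₂ B₀ =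
  map (composeᴵ suc-increasing) (B₀ ∷ᴵ_)
      (pigeonhole₂ (A∪B ∘ suc) a b (subst (_≤ N) (+-suc a b) a+1+b<N))

pigeonhole₃ : ∀ {N} {A B C : Fin N → Set} → (∀ v → A v ⊎ B v ⊎ C v) → ∀ a b c → suc (a + b + c) ≤ N →
              IncreasingIn A (suc a) ⊎ IncreasingIn B (suc b) ⊎ IncreasingIn C (suc c)
pigeonhole₃ {N} A∪B∪C a b c a+b+c<N
  with pigeonhole₂ A∪B∪C a (b + c) (subst (λ s → suc s ≤ N) (+-assoc a b c) a+b+c<N)
... | inj₁ As = inj₁ As
... | inj₂ (enumeration φ φ↑ B∪C) = inj₂ (map (composeᴵ φ↑) (composeᴵ φ↑)
                                        (pigeonhole₂ B∪C b c ≤-refl))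

module _ {N} (c : Colouring N) where

  edgeColour-< : ∀ {u v} → toℕ u < toℕ v → edgeColour c u v ≡ c u v
  edgeColour-< {u} {v} u<v with toℕ u <? toℕ v
  ... | yes _  = refl
  ... | no u≮v = ⊥-elim (u≮v u<v)

  edgeColour-> : ∀ {u v} → toℕ v < toℕ u → edgeColour c u v ≡ c v u
  edgeColour-> {u} {v} v<u with toℕ u <? toℕ v
  ... | yes u<v = ⊥-elim (<-asym u<v v<u)
  ... | no _    = refl

  OrdClique : Bool → ℕ → Set
  OrdClique col k = Σ (Fin k → Fin N) λ φ → StrictlyIncreasing φ ×
    (∀ i j → toℕ i < toℕ j → c (φ i) (φ j) ≡ col)

  ordClique⇒monoClique : ∀ {col k} → OrdClique col k → MonoClique c col k
  ordClique⇒monoClique {col} {k} (φ , φ↑ , mono) = φ , increasing⇒injective φ↑ , edges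
    where
    edges : ∀ i j → i ≢ j → edgeColour c (φ i) (φ j) ≡ col
    edges i j i≢j with <-cmp (toℕ i) (toℕ j)
    ... | tri< i<j _ _ = trans (edgeColour-< (φ↑ i j i<j)) (mono i j i<j)
    ... | tri≈ _ i≡j _ = ⊥-elim (i≢j (toℕ-injective i≡j))
    ... | tri> _ _ j<i = trans (edgeColour-> (φ↑ j i j<i)) (mono j i j<i)

  monoClique⇒ordClique : ∀ {col k} → MonoClique c col k → OrdClique col k
  monoClique⇒ordClique {col} {k} (f , f-inj , mono) with increasing-image f f-inj
  ... | enumeration φ φ↑ φ⊆f = φ , φ↑ , edges
    where
    edges : ∀ i j → toℕ i < toℕ j → c (φ i) (φ j) ≡ col
    edges i j i<j with φ⊆f i | φ⊆f j
    ... | a , fa≡φi | b , fb≡φj =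
      trans (sym (edgeColour-< φi<φj))
            (subst₂ (λ u v → edgeColour c u v ≡ col) fa≡φi fb≡φj (mono a b a≢b))
      where
      φi<φj = φ↑ i j i<j
      a≢b : a ≢ b
      a≢b a≡b = <⇒≢ φi<φj (cong toℕ (trans (sym fa≡φi) (trans (cong f a≡b) fb≡φj)))

  SomeBackEdge AllBackEdges : Bool → Fin N → Set
  SomeBackEdge col v = ∃ λ u → toℕ u < toℕ v × c u v ≡ col
  AllBackEdges col v = ∀ u → toℕ u < toℕ v → c u v ≡ col

  someBackEdge? : ∀ col v → Dec (SomeBackEdge col v)
  someBackEdge? col v = any? (λ u → (toℕ u <? toℕ v) ×-dec (c u v ≟ᵇ col))

  Mixed : Fin N → Set
  Mixed v = SomeBackEdge red v × SomeBackEdge blue v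

  backEdges-trichotomy : ∀ v → AllBackEdges blue v ⊎ AllBackEdges red v ⊎ Mixed v
  backEdges-trichotomy v with someBackEdge? red v | someBackEdge? blue v
  ... | no ¬red | _        = inj₁ (λ u u<v → ¬-not (λ e → ¬red (u , u<v , e)))
  ... | yes _   | no ¬blue = inj₂ (inj₁ (λ u u<v → ¬-not (λ e → ¬blue (u , u<v , e))))
  ... | yes r   | yes b    = inj₂ (inj₂ (r , b))

  PendantClique : Bool → ℕ → Set
  PendantClique col k = Σ (OrdClique col (suc k)) λ K → SomeBackEdge col (proj₁ K zero)

  pendantClique⇒copy : ∀ {col k} → PendantClique col k → MonoCopy c col (Kpend (suc k))
  pendantClique⇒copy {col} {k} ((φ , φ↑ , mono) , w , w<φ₀ , pendant) =
    w ∷ φ , ∷-increasing w<φ φ↑ , edges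
    where
    w<φ : ∀ i → toℕ w < toℕ (φ i)
    w<φ i = <-≤-trans w<φ₀ (increasing⇒monotone φ↑ zero i z≤n)
    edges : ∀ i j → toℕ i < toℕ j → Edge (Kpend (suc k)) i j → c ((w ∷ φ) i) ((w ∷ φ) j) ≡ col
    edges zero    (suc zero)    _         _             = pendant
    edges zero    (suc (suc j)) _         (inj₁ ())
    edges zero    (suc (suc j)) _         (inj₂ (_ , ()))
    edges (suc i) (suc j)       (s≤s i<j) _             = mono i j i<j

  copy⇒pendantClique : ∀ {col k} → MonoCopy c col (Kpend (suc k)) → PendantClique col k
  copy⇒pendantClique (φ , φ↑ , edges) =
    (φ ∘ suc , ∘-increasing φ↑ suc-increasing ,
     λ i j i<j → edges (suc i) (suc j) (s≤s i<j) (inj₁ (s≤s z≤n))) ,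
    φ zero , φ↑ zero (suc zero) (s≤s z≤n) , edges zero (suc zero) (s≤s z≤n) (inj₂ (refl , refl))

mixed⇒copy : ∀ {N} (c : Colouring N) {m n R} → Arrows (suc R) (suc m) (suc n) →
             IncreasingIn (Mixed c) (suc R) →
             MonoCopy c red (Kpend (suc m)) ⊎ MonoCopy c blue (Kpend (suc n))
mixed⇒copy c arrows (enumeration φ φ↑ mixed) =
  map (copyAlong proj₁) (copyAlong proj₂) (arrows (λ i j → c (φ i) (φ j)))
  where
  copyAlong : ∀ {col k} → (∀ {v} → Mixed c v → SomeBackEdge c col v) →
              MonoClique (λ i j → c (φ i) (φ j)) col (suc k) → MonoCopy c col (Kpend (suc k))
  copyAlong pick clique with monoClique⇒ordClique (λ i j → c (φ i) (φ j)) clique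
  ... | ψ , ψ↑ , mono =
    pendantClique⇒copy c ((φ ∘ ψ , ∘-increasing φ↑ ψ↑ , mono) , pick (mixed (ψ zero)))

allBackEdges⇒copy : ∀ {N} (c : Colouring (suc N)) {col k} →
  IncreasingIn (AllBackEdges c col ∘ suc) (suc k) → MonoCopy c col (Kpend (suc k))
allBackEdges⇒copy c (enumeration φ φ↑ all) =
  pendantClique⇒copy c
    ((suc ∘ φ , ∘-increasing suc-increasing φ↑ , λ i j i<j → all j (suc (φ i)) (s≤s (φ↑ i j i<j))) ,
     zero , s≤s z≤n , all zero zero (s≤s z≤n))

upper-bound : ∀ {m n R} → Arrows (suc R) (suc m) (suc n) →
              OrdArrows (suc (suc (n + m + R))) (Kpend (suc m)) (Kpend (suc n))
upper-bound {m} {n} {R} arrows c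
  with pigeonhole₃ (backEdges-trichotomy c ∘ suc) n m R ≤-refl
... | inj₁ blues          = inj₂ (allBackEdges⇒copy c blues)
... | inj₂ (inj₁ reds)    = inj₁ (allBackEdges⇒copy c reds)
... | inj₂ (inj₂ mixeds)  = mixed⇒copy c arrows (composeᴵ suc-increasing mixeds)

toℕ-reduce≥ : ∀ {m n} (i : Fin (m + n)) .(m≤i : m ≤ toℕ i) → toℕ (reduce≥ i m≤i) ≡ toℕ i ∸ m
toℕ-reduce≥ {zero}  i       _   = refl
toℕ-reduce≥ {suc m} (suc i) m≤i = toℕ-reduce≥ {m} i (s≤s⁻¹ m≤i)

module LowerBound (n′ m′ : ℕ) {R} (c : Colouring R) where

  n K : ℕ
  n = suc n′
  K = n + m′

  data Block (x : ℕ) : Set where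
    low  : x < n → Block x
    mid  : n ≤ x → x < K → Block x
    high : K ≤ x → Block x

  block : ∀ x → Block x
  block x with x <? n | x <? K
  ... | yes x<n | _       = low x<n
  ... | no x≮n  | yes x<K = mid (≮⇒≥ x≮n) x<K
  ... | no _    | no x≮K  = high (≮⇒≥ x≮K)

  n≤K : n ≤ K
  n≤K = m≤m+n n m′

  blockColour : (p q : Fin (K + R)) → Block (toℕ p) → Block (toℕ q) → Bool
  blockColour _ _ _          (low _)   = blue
  blockColour _ _ _          (mid _ _) = red
  blockColour _ _ (low _)    (high _)  = red
  blockColour _ _ (mid _ _)  (high _)  = blue
  blockColour p q (high K≤p) (high K≤q) = c (reduce≥ p K≤p) (reduce≥ q K≤q)

  colouring : Colouring (K + R)
  colouring p q = blockColour p q (block (toℕ p)) (block (toℕ q))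

  into-low : ∀ {p q} (bp : Block (toℕ p)) (bq : Block (toℕ q)) → toℕ q < n →
             blockColour p q bp bq ≡ blue
  into-low _ (low _)     _   = refl
  into-low _ (mid n≤q _) q<n = ⊥-elim (<⇒≱ q<n n≤q)
  into-low _ (high K≤q)  q<n = ⊥-elim (<⇒≱ q<n (≤-trans n≤K K≤q))

  into-mid : ∀ {p q} (bp : Block (toℕ p)) (bq : Block (toℕ q)) → n ≤ toℕ q → toℕ q < K →
             blockColour p q bp bq ≡ red
  into-mid _ (low q<n)  n≤q _   = ⊥-elim (<⇒≱ q<n n≤q)
  into-mid _ (mid _ _)  _   _   = refl
  into-mid _ (high K≤q) _   q<K = ⊥-elim (<⇒≱ q<K K≤q)

  low-to-beyond : ∀ {p q} (bp : Block (toℕ p)) (bq : Block (toℕ q)) → toℕ p < n → n ≤ toℕ q →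
                  blockColour p q bp bq ≡ red
  low-to-beyond _          (low q<n) _   n≤q = ⊥-elim (<⇒≱ q<n n≤q)
  low-to-beyond _          (mid _ _) _   _   = refl
  low-to-beyond (low _)    (high _)  _   _   = refl
  low-to-beyond (mid n≤p _) (high _) p<n _   = ⊥-elim (<⇒≱ p<n n≤p)
  low-to-beyond (high K≤p) (high _)  p<n _   = ⊥-elim (<⇒≱ p<n (≤-trans n≤K K≤p))

  mid-to-high : ∀ {p q} (bp : Block (toℕ p)) (bq : Block (toℕ q)) →
                n ≤ toℕ p → toℕ p < K → K ≤ toℕ q → blockColour p q bp bq ≡ blue
  mid-to-high _          (low q<n)   _   _   K≤q = ⊥-elim (<⇒≱ q<n (≤-trans n≤K K≤q))
  mid-to-high _          (mid _ q<K) _   _   K≤q = ⊥-elim (<⇒≱ q<K K≤q)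
  mid-to-high (low p<n)  (high _)    n≤p _   _   = ⊥-elim (<⇒≱ p<n n≤p)
  mid-to-high (mid _ _)  (high _)    _   _   _   = refl
  mid-to-high (high K≤p) (high _)    _   p<K _   = ⊥-elim (<⇒≱ p<K K≤p)

  within-high : ∀ {p q} (bp : Block (toℕ p)) (bq : Block (toℕ q))
                (K≤p : K ≤ toℕ p) (K≤q : K ≤ toℕ q) →
                blockColour p q bp bq ≡ c (reduce≥ p K≤p) (reduce≥ q K≤q)
  within-high _           (low q<n)   _   K≤q = ⊥-elim (<⇒≱ q<n (≤-trans n≤K K≤q))
  within-high _           (mid _ q<K) _   K≤q = ⊥-elim (<⇒≱ q<K K≤q)
  within-high (low p<n)   (high _)    K≤p _   = ⊥-elim (<⇒≱ p<n (≤-trans n≤K K≤p))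
  within-high (mid _ p<K) (high _)    K≤p _   = ⊥-elim (<⇒≱ p<K K≤p)
  within-high (high _)    (high _)    _   _   = refl

  highClique⇒clique : ∀ {col k} → ((φ , _) : OrdClique colouring col (suc k)) → K ≤ toℕ (φ zero) →
               MonoClique c col (suc k)
  highClique⇒clique {col} {k} (φ , φ↑ , mono) K≤φ₀ = ordClique⇒monoClique c (ψ , ψ↑ , edges)
    where
    K≤φ : ∀ i → K ≤ toℕ (φ i)
    K≤φ i = ≤-trans K≤φ₀ (increasing⇒monotone φ↑ zero i z≤n)
    ψ : Fin (suc k) → Fin R
    ψ i = reduce≥ (φ i) (K≤φ i)
    ψ↑ : StrictlyIncreasing ψ
    ψ↑ i j i<j = subst₂ _<_ (sym (toℕ-reduce≥ (φ i) (K≤φ i))) (sym (toℕ-reduce≥ (φ j) (K≤φ j)))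
                        (∸-monoˡ-< (φ↑ i j i<j) (K≤φ i))
    edges : ∀ i j → toℕ i < toℕ j → c (ψ i) (ψ j) ≡ col
    edges i j i<j = trans (sym (within-high (block _) (block _) (K≤φ i) (K≤φ j))) (mono i j i<j)

  redPendant⇒redClique : PendantClique colouring red m′ → MonoClique c red (suc m′)
  redPendant⇒redClique (clique@(φ , φ↑ , mono) , _ , _ , pendant) = byBlock (block (toℕ (φ zero)))
    where
    byBlock : Block (toℕ (φ zero)) → MonoClique c red (suc m′)
    byBlock (low a<n) = ⊥-elim (red≢blue (trans (sym pendant) (into-low (block _) (block _) a<n)))
    byBlock (mid n≤a a<K) =
      ⊥-elim (red≢blue (trans (sym (mono zero (fromℕ m′) 0<last))
                              (mid-to-high (block _) (block _) n≤a a<K K≤e)))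
      where
      K≤e : K ≤ toℕ (φ (fromℕ m′))
      K≤e = ≤-trans (+-monoˡ-≤ m′ n≤a) (increasing-spread φ↑)
      0<last : 0 < toℕ (fromℕ m′)
      0<last = increasing-reflects-< φ↑ zero (fromℕ m′) (<-≤-trans a<K K≤e)
    byBlock (high K≤a) = highClique⇒clique clique K≤a

  bluePendant⇒blueClique : PendantClique colouring blue n′ → MonoClique c blue (suc n′)
  bluePendant⇒blueClique (clique@(φ , φ↑ , mono) , _ , w<a , pendant) = byBlock (block (toℕ (φ zero)))
    where
    byBlock : Block (toℕ (φ zero)) → MonoClique c blue (suc n′)
    byBlock (low a<n) =
      ⊥-elim (red≢blue (trans (sym (low-to-beyond (block _) (block _) a<n n≤e))
                              (mono zero (fromℕ n′) 0<last)))
      where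
      n≤e : n ≤ toℕ (φ (fromℕ n′))
      n≤e = ≤-trans (+-monoˡ-≤ n′ (<-≤-trans (s≤s z≤n) w<a)) (increasing-spread φ↑)
      0<last : 0 < toℕ (fromℕ n′)
      0<last = increasing-reflects-< φ↑ zero (fromℕ n′) (<-≤-trans a<n n≤e)
    byBlock (mid n≤a a<K) =
      ⊥-elim (red≢blue (trans (sym (into-mid (block _) (block _) n≤a a<K)) pendant))
    byBlock (high K≤a) = highClique⇒clique clique K≤a

lower-bound : ∀ {m n R} → ¬ Arrows R (suc m) (suc n) →
              ¬ OrdArrows (suc n + m + R) (Kpend (suc m)) (Kpend (suc n))
lower-bound {m} {n} ¬arrows arrows = ¬arrows λ c → let open LowerBound n m c in
  map (redPendant⇒redClique ∘ copy⇒pendantClique colouring)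
      (bluePendant⇒blueClique ∘ copy⇒pendantClique colouring)
      (arrows colouring)

ordArrows-mono : ∀ {M N H₁ H₂} → M ≤ N → OrdArrows M H₁ H₂ → OrdArrows N H₁ H₂
ordArrows-mono {M} {N} M≤N arrows c = map inject-copy inject-copy (arrows (λ u v → c (ι u) (ι v)))
  where
  ι : Fin M → Fin N
  ι i = inject≤ i M≤N
  ι↑ : StrictlyIncreasing ι
  ι↑ i j = subst₂ _<_ (sym (toℕ-inject≤ i M≤N)) (sym (toℕ-inject≤ j M≤N))
  inject-copy : ∀ {col H} → MonoCopy (λ u v → c (ι u) (ι v)) col H → MonoCopy c col H
  inject-copy (φ , φ↑ , edges) = ι ∘ φ , ∘-increasing ι↑ φ↑ , edges

¬Arrows-zero : ∀ {m n} → ¬ Arrows 0 (suc m) (suc n)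
¬Arrows-zero arrows with arrows (λ ())
... | inj₁ (φ , _) = ¬Fin0 (φ zero)
... | inj₂ (φ , _) = ¬Fin0 (φ zero)

theorem5p4 : (m n : ℕ) → 1 ≤ m → 1 ≤ n → (R : ℕ) → IsRamsey m n R →
    IsOrdRamsey (Kpend m) (Kpend n) (R + m + n ∸ 1)
theorem5p4 (suc m) (suc n) _ _ zero    (arrows , _) = ⊥-elim (¬Arrows-zero arrows)
theorem5p4 (suc m) (suc n) _ _ (suc R) (arrows , minimal) =
  subst (λ N → OrdArrows N (Kpend (suc m)) (Kpend (suc n))) (sym count) (upper-bound arrows) ,
  λ M M<N arrowsM →
    lower-bound (minimal R ≤-refl) (ordArrows-mono (s≤s⁻¹ (subst (M <_) count M<N)) arrowsM)
  where
  -- The left-hand side is what  suc R + suc m + suc n ∸ 1  reduces to.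
  vertex-count : ∀ R m n → R + suc m + suc n ≡ suc (suc (n + m + R))
  vertex-count = solve-∀
  count = vertex-count R m n
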